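{- Let $N=\{n!:n\geqslant1\}$ and let $n$ be a positive integer. The maximum of $p_N(\boldsymbol{\lambda})$ over all $N$-partitions $\boldsymbol{\lambda}$ of $n$ is attained at the partition consisting of $\lfloor n/2\rfloor$ parts equal to $2$ and $n-2\lfloor n/2\rfloor$ parts equal to $1$. Moreover, $$\max\{p_N(\boldsymbol{\lambda}):\boldsymbol{\lambda}\text{ an } N\text{ -partition of } n\}=2^{\lfloor n/2\rfloor}.$$
   Context: An $N$-partition of $n$ is a partition of $n$ all of whose parts are factorials $k!$ with $k\geqslant1$, and $p_N(n)$ is the number of $N$-partitions of $n$. For an $N$-partition $\boldsymbol{\lambda}=(\lambda_1,\ldots,\lambda_j)$, the extended function is $p_N(\boldsymbol{\lambda})=\prod_{i=1}^j p_N(\lambda_i)$. -}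

module Defs where

open import Data.Nat using (ℕ; zero; suc; _+_; _*_; _∸_; _≤_; _≤ᵇ_; _≡ᵇ_; _!)

open import Data.Bool using (if_then_else_)
open import Data.List using (List; []; _∷_; _++_; map; concatMap; upTo; replicate; length)
open import Data.Nat.ListAction using (sum; product)
open import Data.List.Relation.Unary.All using (All)
open import Data.List.Relation.Unary.Linked using (Linked)
open import Data.Product using (∃-syntax; _×_)
open import Relation.Binary.PropositionalEquality using (_≡_)

IsFactorial : ℕ → Set
IsFactorial x = ∃[ k ] (1 ≤ k × x ≡ k !)

IsNPartition : ℕ → List ℕ → Set
IsNPartition n λs = sum λs ≡ n × All IsFactorial λs × Linked (λ a b → b ≤ a) λs

enum : ℕ → ℕ → List (List ℕ)
enum zero n = if n ≡ᵇ 0 then ([] ∷ []) else []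
enum (suc k) n =
  concatMap
    (λ j → if (j * (suc k) !) ≤ᵇ n
             then map (replicate j ((suc k) !) ++_) (enum k (n ∸ j * (suc k) !))
             else [])
    (upTo (suc n))

-- p_N(n): the number of N-partitions of n.  Parts are ≤ n, and k! ≥ k,
-- so factorials up to n! suffice.
pN : ℕ → ℕ
pN n = length (enum n n)

pNext : List ℕ → ℕ
pNext λs = product (map pN λs)

-- Let P_k(m) be the number of partitions of m into parts 1!, …, k!.  Sorting the
-- partitions counted by P_{k+1} by their number of parts (k+1)! gives P_{k+1}(m) = P_k(m)
-- for m < (k+1)! and P_{k+1}((k+1)! + y) = P_k((k+1)! + y) + P_{k+1}(y).  From this,
-- by induction on k ≥ 2 starting at P_2(m) = 1 + ⌊m/2⌋, P_k(m+2) ≤ 2 P_k(m) for all m,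
-- and even P_k(m+2) + ⌊m/2⌋ ≤ 2 P_k(m) for m ≥ k!.  The gap ⌊m/2⌋ pays for the one extra
-- partition ((k+1)! plus at most one 1) that P_{k+1}(m+2) has over P_k(m+2) when
-- m < (k+1)! ≤ m + 2.  Hence p_N(m) = P_m(m) ≤ 2^⌊m/2⌋, and as ⌊a/2⌋ + ⌊b/2⌋ ≤ ⌊(a+b)/2⌋
-- the bound 2^⌊n/2⌋ holds for p_N(λ) whenever λ is an N-partition of n.  It is attained
-- by the 2's and at most one 1, since p_N(2) = 2 and p_N(1) = 1.
module Submission where

open import Defs
open import Data.Nat using (ℕ; _≤_; _^_; _/_; _%_; _∸_; _*_)
open import Data.List using (List; replicate; _++_)
open import Data.Product using (_×_)
open import Relation.Binary.PropositionalEquality using (_≡_)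

open import Data.Bool using (Bool; true; false; if_then_else_)
open import Data.Bool.Properties using (if-float)
open import Data.List using ([]; _∷_; map; concatMap; applyUpTo; upTo; length)
open import Data.List.Properties
  using (length-++; length-map; map-applyUpTo; map-++; map-replicate)
import Data.List.Relation.Unary.All.Properties as All
open import Data.List.Relation.Unary.Linked using (Linked; []; [-]; _∷_)
open import Data.Nat
  using (zero; suc; _+_; _<_; _≥_; _!; _≤ᵇ_; z≤n; s≤s; z<s; s<s; ⌊_/2⌋)
open import Data.Nat.DivMod using (m/n≡1+[m∸n]/n; m/n*n≤m)
open import Data.Nat.Induction using (<-rec)
open import Data.Nat.ListAction using (sum; product)
open import Data.Nat.ListAction.Properties using (sum-++; product-++)
open import Data.Nat.Properties
open import Algebra.Properties.CommutativeSemigroup +-commutativeSemigroup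
  using () renaming (xy∙z≈xz∙y to +-right-comm)
open import Data.Nat.Tactic.RingSolver using (solve-∀)
open import Data.Product using (_,_)
open import Data.Unit using (tt)
open import Function using (_∘_; id)
open import Relation.Binary.PropositionalEquality
  using (refl; sym; trans; cong; cong₂; subst; _≗_; module ≡-Reasoning)
open import Relation.Nullary using (yes; no; contradiction)

length-concatMap : {A B : Set} (f : A → List B) (xs : List A) →
                   length (concatMap f xs) ≡ sum (map (length ∘ f) xs)
length-concatMap f []       = refl
length-concatMap f (x ∷ xs) =
  trans (length-++ (f x)) (cong (length (f x) +_) (length-concatMap f xs))

length-if-map : {A B : Set} (b : Bool) (f : A → B) (xs : List A) →
                length (if b then map f xs else []) ≡ (if b then length xs else 0)
length-if-map b f xs =
  trans (if-float length b) (cong (λ l → if b then l else 0) (length-map f xs))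

sum-applyUpTo-cong : ∀ {f g : ℕ → ℕ} → f ≗ g → ∀ n →
                     sum (applyUpTo f n) ≡ sum (applyUpTo g n)
sum-applyUpTo-cong f≗g zero    = refl
sum-applyUpTo-cong f≗g (suc n) = cong₂ _+_ (f≗g 0) (sum-applyUpTo-cong (f≗g ∘ suc) n)

sum-applyUpTo-truncate : ∀ (f : ℕ → ℕ) {m} n → (∀ j → m ≤ j → f j ≡ 0) → m ≤ n →
                         sum (applyUpTo f n) ≡ sum (applyUpTo f m)
sum-applyUpTo-truncate f zero    f≡0 z≤n       = refl
sum-applyUpTo-truncate f (suc n) f≡0 z≤n       =
  cong₂ _+_ (f≡0 0 z≤n) (sum-applyUpTo-truncate (f ∘ suc) n (λ j _ → f≡0 (suc j) z≤n) z≤n)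
sum-applyUpTo-truncate f (suc n) f≡0 (s≤s m≤n) =
  cong (f 0 +_) (sum-applyUpTo-truncate (f ∘ suc) n (λ j m≤j → f≡0 (suc j) (s≤s m≤j)) m≤n)

≤ᵇ-suc : ∀ m n → (suc m ≤ᵇ suc n) ≡ (m ≤ᵇ n)
≤ᵇ-suc zero    n = refl
≤ᵇ-suc (suc m) n = refl

+-cancelˡ-≤ᵇ : ∀ m n o → (m + n ≤ᵇ m + o) ≡ (n ≤ᵇ o)
+-cancelˡ-≤ᵇ zero    n o = refl
+-cancelˡ-≤ᵇ (suc m) n o = trans (≤ᵇ-suc (m + n) (m + o)) (+-cancelˡ-≤ᵇ m n o)

nPartitions : ℕ → ℕ → ℕ
nPartitions k n = length (enum k n)

partitionsWith : ℕ → ℕ → ℕ → List (List ℕ)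
partitionsWith k n j =
  if j * suc k ! ≤ᵇ n then map (replicate j (suc k !) ++_) (enum k (n ∸ j * suc k !)) else []

nPartitionsWith : ℕ → ℕ → ℕ → ℕ
nPartitionsWith k n j =
  if j * suc k ! ≤ᵇ n then nPartitions k (n ∸ j * suc k !) else 0

nPartitions-suc : ∀ k n →
                  nPartitions (suc k) n ≡ sum (applyUpTo (nPartitionsWith k n) (suc n))
nPartitions-suc k n = begin
  length (concatMap (partitionsWith k n) (upTo (suc n)))
    ≡⟨ length-concatMap (partitionsWith k n) (upTo (suc n)) ⟩
  sum (map (length ∘ partitionsWith k n) (upTo (suc n)))
    ≡⟨ cong sum (map-applyUpTo id (length ∘ partitionsWith k n) (suc n)) ⟩
  sum (applyUpTo (length ∘ partitionsWith k n) (suc n))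
    ≡⟨ sum-applyUpTo-cong length-partitionsWith (suc n) ⟩
  sum (applyUpTo (nPartitionsWith k n) (suc n)) ∎
  where
  open ≡-Reasoning
  length-partitionsWith : ∀ j → length (partitionsWith k n j) ≡ nPartitionsWith k n j
  length-partitionsWith j = length-if-map (j * suc k ! ≤ᵇ n) _ (enum k (n ∸ j * suc k !))

nPartitionsWith-vanish : ∀ k n j → n < j * suc k ! → nPartitionsWith k n j ≡ 0
nPartitionsWith-vanish k n j n<jF with j * suc k ! ≤ᵇ n | ≤ᵇ⇒≤ (j * suc k !) n
... | true  | jF≤n = contradiction (jF≤n tt) (<⇒≱ n<jF)
... | false | _    = refl

nPartitionsWith-shift : ∀ k y j →
                        nPartitionsWith k (suc k ! + y) (suc j) ≡ nPartitionsWith k y j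
nPartitionsWith-shift k y j rewrite +-cancelˡ-≤ᵇ (suc k !) (j * suc k !) y =
  cong (λ x → if j * suc k ! ≤ᵇ y then nPartitions k x else 0)
       ([m+n]∸[m+o]≡n∸o (suc k !) y (j * suc k !))

nPartitions-below : ∀ k n → n < suc k ! → nPartitions (suc k) n ≡ nPartitions k n
nPartitions-below k n n<F = begin
  nPartitions (suc k) n
    ≡⟨ nPartitions-suc k n ⟩
  nPartitions k n + sum (applyUpTo (nPartitionsWith k n ∘ suc) n)
    ≡⟨ cong (nPartitions k n +_)
            (sum-applyUpTo-truncate (nPartitionsWith k n ∘ suc) n vanish z≤n) ⟩
  nPartitions k n + 0
    ≡⟨ +-identityʳ _ ⟩
  nPartitions k n ∎
  where
  open ≡-Reasoning
  vanish : ∀ j → 0 ≤ j → nPartitionsWith k n (suc j) ≡ 0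
  vanish j _ =
    nPartitionsWith-vanish k n (suc j) (≤-trans n<F (m≤m+n (suc k !) (j * suc k !)))

nPartitions-above : ∀ k y →
  nPartitions (suc k) (suc k ! + y) ≡ nPartitions k (suc k ! + y) + nPartitions (suc k) y
nPartitions-above k y = begin
  nPartitions (suc k) (F + y)
    ≡⟨ nPartitions-suc k (F + y) ⟩
  nPartitions k (F + y) + sum (applyUpTo (nPartitionsWith k (F + y) ∘ suc) (F + y))
    ≡⟨ cong (nPartitions k (F + y) +_)
            (sum-applyUpTo-cong (nPartitionsWith-shift k y) (F + y)) ⟩
  nPartitions k (F + y) + sum (applyUpTo (nPartitionsWith k y) (F + y))
    ≡⟨ cong (nPartitions k (F + y) +_)
            (sum-applyUpTo-truncate (nPartitionsWith k y) (F + y) vanish suc-y≤F+y) ⟩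
  nPartitions k (F + y) + sum (applyUpTo (nPartitionsWith k y) (suc y))
    ≡⟨ cong (nPartitions k (F + y) +_) (nPartitions-suc k y) ⟨
  nPartitions k (F + y) + nPartitions (suc k) y ∎
  where
  open ≡-Reasoning
  F : ℕ
  F = suc k !
  vanish : ∀ j → suc y ≤ j → nPartitionsWith k y j ≡ 0
  vanish j y<j = nPartitionsWith-vanish k y j (≤-trans y<j (m≤m*n j F {{suc k !≢0}}))
  suc-y≤F+y : suc y ≤ F + y
  suc-y≤F+y = +-monoˡ-≤ y (1≤n! (suc k))

nPartitions[k,0]≡1 : ∀ k → nPartitions k 0 ≡ 1
nPartitions[k,0]≡1 zero    = refl
nPartitions[k,0]≡1 (suc k) =
  trans (nPartitions-below k 0 (1≤n! (suc k))) (nPartitions[k,0]≡1 k)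

2≤[2+n]! : ∀ n → 2 ≤ (2 + n) !
2≤[2+n]! n = ≤-trans (m≤m+n 2 n) (m≤m*n (2 + n) ((1 + n) !) {{(1 + n) !≢0}})

nPartitions[1+k,1]≡1 : ∀ k → nPartitions (suc k) 1 ≡ 1
nPartitions[1+k,1]≡1 zero    = refl
nPartitions[1+k,1]≡1 (suc k) =
  trans (nPartitions-below (suc k) 1 (2≤[2+n]! k)) (nPartitions[1+k,1]≡1 k)

nPartitions[1,n]≡1 : ∀ n → nPartitions 1 n ≡ 1
nPartitions[1,n]≡1 zero    = refl
nPartitions[1,n]≡1 (suc n) = trans (nPartitions-above 0 n) (nPartitions[1,n]≡1 n)

nPartitions[2,n]≡1+⌊n/2⌋ : ∀ n → nPartitions 2 n ≡ suc ⌊ n /2⌋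
nPartitions[2,n]≡1+⌊n/2⌋ 0             = refl
nPartitions[2,n]≡1+⌊n/2⌋ 1             = refl
nPartitions[2,n]≡1+⌊n/2⌋ (suc (suc n)) =
  trans (nPartitions-above 1 n)
        (cong₂ _+_ (nPartitions[1,n]≡1 (2 + n)) (nPartitions[2,n]≡1+⌊n/2⌋ n))

record Subdoubling (K : ℕ) (a : ℕ → ℕ) : Set where
  field
    doubling          : ∀ m → a (2 + m) ≤ 2 * a m
    doubling-with-gap : ∀ m → K ≤ m → a (2 + m) + ⌊ m /2⌋ ≤ 2 * a m
open Subdoubling

data Position (F m : ℕ) : Set where
  below    : 2 + m < F → Position F m
  straddle : ∀ y → y < 2 → y + F ≡ 2 + m → Position F m
  above    : ∀ y → y + F ≡ m → Position F m

position : ∀ F m → Position F m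
position F m with 2 + m <? F
... | yes 2+m<F = below 2+m<F
... | no  2+m≮F = split (2 + m ∸ F) (m∸n+n≡m (≮⇒≥ 2+m≮F))
  where
  split : ∀ y → y + F ≡ 2 + m → Position F m
  split 0             eq = straddle 0 z<s eq
  split 1             eq = straddle 1 (s<s z<s) eq
  split (suc (suc y)) eq = above y (cong (_∸ 2) eq)

module _ {K F : ℕ} {a b : ℕ → ℕ}
         (2≤K : 2 ≤ K) (2+K≤F : 2 + K ≤ F) (a≤1 : ∀ y → y < 2 → a y ≤ 1)
         (b-below : ∀ x → x < F → b x ≡ a x)
         (b-above : ∀ y → b (F + y) ≡ a (F + y) + b y)
         (sub-a : Subdoubling K a) where

  private
    b-above′ : ∀ y → b (y + F) ≡ a (y + F) + b y
    b-above′ y = subst (λ x → b x ≡ a x + b y) (+-comm F y) (b-above y)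

    K≤F : K ≤ F
    K≤F = ≤-trans (m≤n+m K 2) 2+K≤F

    2≤F : 2 ≤ F
    2≤F = ≤-trans 2≤K K≤F

    gap-above : ∀ y → b (2 + y) ≤ 2 * b y →
                b (2 + (y + F)) + ⌊ y + F /2⌋ ≤ 2 * b (y + F)
    gap-above y b-doubles = begin
      b (2 + m) + h                   ≡⟨ cong (_+ h) (b-above′ (2 + y)) ⟩
      a (2 + m) + b (2 + y) + h       ≡⟨ +-right-comm (a (2 + m)) (b (2 + y)) h ⟩
      a (2 + m) + h + b (2 + y)       ≤⟨ +-mono-≤ (doubling-with-gap sub-a m K≤m) b-doubles ⟩
      2 * a m + 2 * b y               ≡⟨ *-distribˡ-+ 2 (a m) (b y) ⟨
      2 * (a m + b y)                 ≡⟨ cong (2 *_) (b-above′ y) ⟨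
      2 * b m                         ∎
      where
      open ≤-Reasoning
      m h : ℕ
      m = y + F
      h = ⌊ m /2⌋
      K≤m : K ≤ m
      K≤m = ≤-trans K≤F (m≤n+m F y)

    doubling-below : ∀ m → 2 + m < F → b (2 + m) ≤ 2 * b m
    doubling-below m 2+m<F = begin
      b (2 + m)  ≡⟨ b-below (2 + m) 2+m<F ⟩
      a (2 + m)  ≤⟨ doubling sub-a m ⟩
      2 * a m    ≡⟨ cong (2 *_) (b-below m (≤-<-trans (m≤n+m m 2) 2+m<F)) ⟨
      2 * b m    ∎
      where open ≤-Reasoning

    doubling-straddle : ∀ m y → y < 2 → y + F ≡ 2 + m → b (2 + m) ≤ 2 * b m
    doubling-straddle m y y<2 eq = begin
      b (2 + m)              ≡⟨ cong b eq ⟨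
      b (y + F)              ≡⟨ b-above′ y ⟩
      a (y + F) + b y        ≡⟨ cong₂ _+_ (cong a eq) (b-below y (<-≤-trans y<2 2≤F)) ⟩
      a (2 + m) + a y        ≤⟨ +-monoʳ-≤ (a (2 + m)) (≤-trans (a≤1 y y<2) (⌊n/2⌋-mono 2≤m)) ⟩
      a (2 + m) + ⌊ m /2⌋    ≤⟨ doubling-with-gap sub-a m K≤m ⟩
      2 * a m                ≡⟨ cong (2 *_) (b-below m m<F) ⟨
      2 * b m                ∎
      where
      open ≤-Reasoning
      2+K≤2+m : 2 + K ≤ 2 + m
      2+K≤2+m = ≤-trans 2+K≤F (subst (F ≤_) eq (m≤n+m F y))
      K≤m : K ≤ m
      K≤m = +-cancelˡ-≤ 2 K m 2+K≤2+m
      2≤m : 2 ≤ m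
      2≤m = ≤-trans 2≤K K≤m
      m<F : m < F
      m<F = +-cancelˡ-< 2 m F (subst (_< 2 + F) eq (+-monoˡ-< F y<2))

    doubling-b : ∀ m → b (2 + m) ≤ 2 * b m
    doubling-b = <-rec _ step
      where
      step : ∀ m → (∀ {y} → y < m → b (2 + y) ≤ 2 * b y) → b (2 + m) ≤ 2 * b m
      step m rec with position F m
      ... | below 2+m<F       = doubling-below m 2+m<F
      ... | straddle y y<2 eq = doubling-straddle m y y<2 eq
      ... | above y refl      =
        ≤-trans (m≤m+n _ _) (gap-above y (rec (m<m+n y (≤-trans (s≤s z≤n) 2≤F))))

  subdoubling-extend : Subdoubling F b
  subdoubling-extend = record
    { doubling          = doubling-b
    ; doubling-with-gap = λ m F≤m →
        subst (λ x → b (2 + x) + ⌊ x /2⌋ ≤ 2 * b x) (m∸n+n≡m F≤m)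
              (gap-above (m ∸ F) (doubling-b (m ∸ F)))
    }

2+n!≤[1+n]! : ∀ n → 2 ≤ n → 2 + n ! ≤ suc n !
2+n!≤[1+n]! n 2≤n = subst (2 + n ! ≤_) (+-comm (n * n !) (n !))
  (+-monoˡ-≤ (n !) (≤-trans 2≤n (m≤m*n n (n !) {{n !≢0}})))

nPartitions-subdoubling : ∀ d → Subdoubling ((2 + d) !) (nPartitions (2 + d))
nPartitions-subdoubling zero = record
  { doubling          = λ m → ≤-trans (m≤m+n _ _) (gap m)
  ; doubling-with-gap = λ m _ → gap m
  }
  where
  gap : ∀ m → nPartitions 2 (2 + m) + ⌊ m /2⌋ ≤ 2 * nPartitions 2 m
  gap m rewrite nPartitions[2,n]≡1+⌊n/2⌋ (2 + m) | nPartitions[2,n]≡1+⌊n/2⌋ m =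
    ≤-reflexive (2+h+h≡2*[1+h] ⌊ m /2⌋)
    where
    2+h+h≡2*[1+h] : ∀ h → 2 + h + h ≡ 2 * (1 + h)
    2+h+h≡2*[1+h] = solve-∀
nPartitions-subdoubling (suc d) =
  subdoubling-extend (2≤[2+n]! d) (2+n!≤[1+n]! (2 + d) (m≤m+n 2 d)) a≤1
                     (nPartitions-below (2 + d)) (nPartitions-above (2 + d))
                     (nPartitions-subdoubling d)
  where
  a≤1 : ∀ y → y < 2 → nPartitions (2 + d) y ≤ 1
  a≤1 0 _ = ≤-reflexive (nPartitions[k,0]≡1 (2 + d))
  a≤1 1 _ = ≤-reflexive (nPartitions[1+k,1]≡1 (1 + d))
  a≤1 (suc (suc y)) (s≤s (s≤s ()))

doubling⇒≤2^⌊n/2⌋ : ∀ (a : ℕ → ℕ) → a 0 ≤ 1 → a 1 ≤ 1 → (∀ m → a (2 + m) ≤ 2 * a m) →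
                     ∀ n → a n ≤ 2 ^ ⌊ n /2⌋
doubling⇒≤2^⌊n/2⌋ a a₀ a₁ dbl 0             = a₀
doubling⇒≤2^⌊n/2⌋ a a₀ a₁ dbl 1             = a₁
doubling⇒≤2^⌊n/2⌋ a a₀ a₁ dbl (suc (suc n)) =
  ≤-trans (dbl n) (*-monoʳ-≤ 2 (doubling⇒≤2^⌊n/2⌋ a a₀ a₁ dbl n))

pN≤2^⌊n/2⌋ : ∀ n → pN n ≤ 2 ^ ⌊ n /2⌋
pN≤2^⌊n/2⌋ 0             = ≤-refl
pN≤2^⌊n/2⌋ 1             = ≤-refl
pN≤2^⌊n/2⌋ (suc (suc d)) =
  doubling⇒≤2^⌊n/2⌋ (nPartitions (2 + d))
                     (≤-reflexive (nPartitions[k,0]≡1 (2 + d)))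
                     (≤-reflexive (nPartitions[1+k,1]≡1 (1 + d)))
                     (doubling (nPartitions-subdoubling d)) (2 + d)

⌊m/2⌋+⌊n/2⌋≤⌊m+n/2⌋ : ∀ m n → ⌊ m /2⌋ + ⌊ n /2⌋ ≤ ⌊ m + n /2⌋
⌊m/2⌋+⌊n/2⌋≤⌊m+n/2⌋ 0             n = ≤-refl
⌊m/2⌋+⌊n/2⌋≤⌊m+n/2⌋ 1             n = ⌊n/2⌋-mono (n≤1+n n)
⌊m/2⌋+⌊n/2⌋≤⌊m+n/2⌋ (suc (suc m)) n = s≤s (⌊m/2⌋+⌊n/2⌋≤⌊m+n/2⌋ m n)

product-map-≤2^⌊sum/2⌋ : ∀ {f : ℕ → ℕ} → (∀ x → f x ≤ 2 ^ ⌊ x /2⌋) → ∀ xs →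
                         product (map f xs) ≤ 2 ^ ⌊ sum xs /2⌋
product-map-≤2^⌊sum/2⌋ f≤ []       = ≤-refl
product-map-≤2^⌊sum/2⌋ {f} f≤ (x ∷ xs) = begin
  f x * product (map f xs)         ≤⟨ *-mono-≤ (f≤ x) (product-map-≤2^⌊sum/2⌋ f≤ xs) ⟩
  2 ^ ⌊ x /2⌋ * 2 ^ ⌊ sum xs /2⌋   ≡⟨ ^-distribˡ-+-* 2 ⌊ x /2⌋ ⌊ sum xs /2⌋ ⟨
  2 ^ (⌊ x /2⌋ + ⌊ sum xs /2⌋)     ≤⟨ ^-monoʳ-≤ 2 (⌊m/2⌋+⌊n/2⌋≤⌊m+n/2⌋ x (sum xs)) ⟩
  2 ^ ⌊ x + sum xs /2⌋             ∎
  where open ≤-Reasoning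

⌊n/2⌋≡n/2 : ∀ n → ⌊ n /2⌋ ≡ n / 2
⌊n/2⌋≡n/2 0             = refl
⌊n/2⌋≡n/2 1             = refl
⌊n/2⌋≡n/2 (suc (suc n)) =
  trans (cong suc (⌊n/2⌋≡n/2 n)) (sym (m/n≡1+[m∸n]/n {2 + n} {2} (s≤s (s≤s z≤n))))

sum-replicate : ∀ n x → sum (replicate n x) ≡ n * x
sum-replicate zero    x = refl
sum-replicate (suc n) x = cong (x +_) (sum-replicate n x)

product-replicate : ∀ n x → product (replicate n x) ≡ x ^ n
product-replicate zero    x = refl
product-replicate (suc n) x = cong (x *_) (product-replicate n x)

replicate-descending : ∀ n x → Linked _≥_ (replicate n x)
replicate-descending 0             x = []
replicate-descending 1             x = [-]
replicate-descending (suc (suc n)) x = ≤-refl ∷ replicate-descending (suc n) x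

replicate-++-replicate-descending : ∀ {x y} → y ≤ x → ∀ q r →
                                    Linked _≥_ (replicate q x ++ replicate r y)
replicate-++-replicate-descending y≤x 0             r       = replicate-descending r _
replicate-++-replicate-descending y≤x 1             0       = [-]
replicate-++-replicate-descending y≤x 1             (suc r) = y≤x ∷ replicate-descending (suc r) _
replicate-++-replicate-descending y≤x (suc (suc q)) r       =
  ≤-refl ∷ replicate-++-replicate-descending y≤x (suc q) r

twosAndOnes-isNPartition : ∀ q r → IsNPartition (2 * q + r) (replicate q 2 ++ replicate r 1)
twosAndOnes-isNPartition q r =
    sum-twosAndOnes
  , All.++⁺ (All.replicate⁺ q (2 , s≤s z≤n , refl)) (All.replicate⁺ r (1 , ≤-refl , refl))
  , replicate-++-replicate-descending (s≤s z≤n) q r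
  where
  open ≡-Reasoning
  sum-twosAndOnes : sum (replicate q 2 ++ replicate r 1) ≡ 2 * q + r
  sum-twosAndOnes = begin
    sum (replicate q 2 ++ replicate r 1)          ≡⟨ sum-++ (replicate q 2) (replicate r 1) ⟩
    sum (replicate q 2) + sum (replicate r 1)     ≡⟨ cong₂ _+_ (sum-replicate q 2) (sum-replicate r 1) ⟩
    q * 2 + r * 1                                 ≡⟨ cong₂ _+_ (*-comm q 2) (*-identityʳ r) ⟩
    2 * q + r                                     ∎

pNext-replicate : ∀ q x → pNext (replicate q x) ≡ pN x ^ q
pNext-replicate q x = trans (cong product (map-replicate pN q x)) (product-replicate q (pN x))

pNext-twosAndOnes : ∀ q r → pNext (replicate q 2 ++ replicate r 1) ≡ 2 ^ q
pNext-twosAndOnes q r = begin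
  product (map pN (replicate q 2 ++ replicate r 1))
    ≡⟨ cong product (map-++ pN (replicate q 2) (replicate r 1)) ⟩
  product (map pN (replicate q 2) ++ map pN (replicate r 1))
    ≡⟨ product-++ (map pN (replicate q 2)) (map pN (replicate r 1)) ⟩
  pNext (replicate q 2) * pNext (replicate r 1)
    ≡⟨ cong₂ _*_ (pNext-replicate q 2) (trans (pNext-replicate r 1) (^-zeroˡ r)) ⟩
  2 ^ q * 1
    ≡⟨ *-identityʳ (2 ^ q) ⟩
  2 ^ q ∎
  where open ≡-Reasoning

theorem6p4 : (n : ℕ) → 1 ≤ n →
    (IsNPartition n (replicate (n / 2) 2 ++ replicate (n ∸ 2 * (n / 2)) 1)
      × pNext (replicate (n / 2) 2 ++ replicate (n ∸ 2 * (n / 2)) 1) ≡ 2 ^ (n / 2)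
      × ((λs : List ℕ) → IsNPartition n λs → pNext λs ≤ 2 ^ (n / 2)))
theorem6p4 n _ =
    subst (λ m → IsNPartition m (replicate q 2 ++ replicate (n ∸ 2 * q) 1)) 2q+r≡n
          (twosAndOnes-isNPartition q (n ∸ 2 * q))
  , pNext-twosAndOnes q (n ∸ 2 * q)
  , λ λs (sum≡n , _) →
      subst (λ e → pNext λs ≤ 2 ^ e) (trans (cong ⌊_/2⌋ sum≡n) (⌊n/2⌋≡n/2 n))
            (product-map-≤2^⌊sum/2⌋ pN≤2^⌊n/2⌋ λs)
  where
  q : ℕ
  q = n / 2
  2q+r≡n : 2 * q + (n ∸ 2 * q) ≡ n
  2q+r≡n = m+[n∸m]≡n (subst (_≤ n) (*-comm q 2) (m/n*n≤m n 2))
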